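{- For every integer $n\ge1$, \[ (-1)^n\frac{D_n}{n!}=\sum_{m=1}^{n}\binom{n-1}{m-1}\frac{\widehat{D}_m}{m!}, \qquad (-1)^n\frac{\widehat{D}_n}{n!}=\sum_{m=1}^{n}\binom{n-1}{m-1}\frac{D_m}{m!}. \]
   Context: The Daehee numbers $D_n$ are defined by $\frac{\log(1+t)}{t}=\sum_{n\ge0}D_n\frac{t^n}{n!}$. The Daehee numbers of the second kind $\widehat{D}_n$ are defined by $\frac{(1+t)\log(1+t)}{t}=\sum_{n\ge0}\widehat{D}_n\frac{t^n}{n!}$ (equivalently, $\widehat{D}_n=\int_{\mathbb{Z}_p}(-x)_n\,d\mu_0(x)$ where $\int_{\mathbb{Z}_p}f\,d\mu_0=\lim_{N\to\infty}p^{ -N}\sum_{x=0}^{p^N-1}f(x)$ is the Volkenborn integral and $(z)_n=z(z-1)\cdots(z-n+1)$). -}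

module Defs where

open import Data.Nat using (ℕ; zero; suc)
open import Data.Nat.Properties using (_!≢0)
open import Data.Nat.Combinatorics using (_C_)
open import Data.Nat.Base using (_!)
open import Data.Integer using (+_; -[1+_])
open import Data.Rational using (ℚ; _/_; _+_; _*_; 0ℚ; 1ℚ; -_)
open import Data.List using (List; map; foldr; upTo)

-- formal power series over ℚ, given by their coefficient sequence
FPS : Set
FPS = ℕ → ℚ

sgn : ℕ → ℚ
sgn zero    = 1ℚ
sgn (suc n) = - sgn n

log1+t : FPS
log1+t zero    = 0ℚ
log1+t (suc k) = sgn k * ((+ 1) / (suc k))

-- f(t)/t  (for f with zero constant term)
divT : FPS → FPS
divT f n = f (suc n)

mul1+t : FPS → FPS
mul1+t f zero    = f zero
mul1+t f (suc n) = f (suc n) + f n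

ℕ→ℚ : ℕ → ℚ
ℕ→ℚ n = (+ n) / 1

invFact : ℕ → ℚ
invFact n = _/_ (+ 1) (n !) {{n !≢0}}

-- Daehee numbers: log(1+t)/t = Σ D_n t^n / n!
D : ℕ → ℚ
D n = ℕ→ℚ (n !) * divT log1+t n

-- Daehee numbers of the second kind: (1+t)log(1+t)/t = Σ D̂_n t^n / n!
Dhat : ℕ → ℚ
Dhat n = ℕ→ℚ (n !) * mul1+t (divT log1+t) n

sum1to : ℕ → (ℕ → ℚ) → ℚ
sum1to n f = foldr _+_ 0ℚ (map (λ k → f (suc k)) (upTo n))

-- Dividing by n! turns both generating functions into explicit coefficients:
-- D n / n! = (-1)^n/(n+1), and D̂ (k+1)/(k+1)! = (-1)^k (1/(k+1) - 1/(k+2)).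
-- Both identities thus reduce to the binomial transforms
--   Σ_k C(N,k) (-1)^k/(k+1) = 1/(N+1),   Σ_k C(N,k) (-1)^k/(k+2) = 1/(N+1) - 1/(N+2).
-- The first follows from the absorption identity (N+1) C(N,k)/(k+1) = C(N+1,k+1)
-- and the vanishing of alternating binomial sums; the second from the first by
-- Pascal's rule.
module Submission where

open import Algebra.Bundles using (CommutativeRing)
open import Data.Fin using (Fin; zero; suc; toℕ)
import Data.Integer as ℤ
import Data.Integer.Tactic.RingSolver as ℤ-Solver
open import Data.List using (foldr; map; applyUpTo)
open import Data.Nat as ℕ using (ℕ; zero; suc; NonZero; _≤_; _<_; _∸_; s≤s; _!)
open import Data.Nat.Combinatorics using (_C_; nC1≡n; nCk+nC[k+1]≡[n+1]C[k+1])
open import Data.Nat.Properties using (_!≢0; n<1+n)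
import Data.Nat.Properties as ℕ
import Data.Nat.Tactic.RingSolver as ℕ-Solver
open import Data.Product using (_×_; _,_)
open import Data.Rational
  using (ℚ; _/_; _+_; _*_; _-_; -_; 0ℚ; 1ℚ; fromℚᵘ)
open import Data.Rational.Properties
  using ( +-*-commutativeRing; toℚᵘ-injective; toℚᵘ-fromℚᵘ; fromℚᵘ-cong
        ; toℚᵘ-homo-+; toℚᵘ-homo-*; +-identityˡ; +-identityʳ; +-inverseʳ; neg-distrib-+; neg-distribʳ-*
        ; neg-distribˡ-*; +-assoc; *-identityˡ; *-identityʳ; *-zeroˡ; *-assoc)
open import Data.Rational.Solver using (module +-*-Solver)
open +-*-Solver using (solve; _:+_; _:*_; :-_; _:-_; _:=_; con)
import Data.Rational.Unnormalised as ℚᵘ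
import Data.Rational.Unnormalised.Properties as ℚᵘ
open import Function.Base using (_∘_; id)
open import Relation.Binary.PropositionalEquality

open import Algebra.Properties.Semiring.Sum (CommutativeRing.semiring +-*-commutativeRing)
  using (sum; sum-syntax; sum-cong-≗; ∑-distrib-+; *-distribˡ-sum; sum-replicate-zero)

open import Defs

[k+1]*[n+1]C[k+1]≡[n+1]*nCk : ∀ n k → suc k ℕ.* (suc n C suc k) ≡ suc n ℕ.* (n C k)
[k+1]*[n+1]C[k+1]≡[n+1]*nCk zero    zero    = refl
[k+1]*[n+1]C[k+1]≡[n+1]*nCk zero    (suc k) = ℕ.*-zeroʳ (2 ℕ.+ k)
[k+1]*[n+1]C[k+1]≡[n+1]*nCk (suc n) zero    =
  trans (ℕ.*-identityˡ _) (trans (nC1≡n (2 ℕ.+ n)) (sym (ℕ.*-identityʳ (2 ℕ.+ n))))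
[k+1]*[n+1]C[k+1]≡[n+1]*nCk (suc n) (suc k) = begin
  (2 ℕ.+ k) ℕ.* (suc (suc n) C suc (suc k))
    ≡⟨ cong ((2 ℕ.+ k) ℕ.*_) (nCk+nC[k+1]≡[n+1]C[k+1] (suc n) (suc k)) ⟨
  (2 ℕ.+ k) ℕ.* (a ℕ.+ b)
    ≡⟨ distribute k a b ⟩
  a ℕ.+ ((1 ℕ.+ k) ℕ.* a ℕ.+ (2 ℕ.+ k) ℕ.* b)
    ≡⟨ cong (a ℕ.+_) (cong₂ ℕ._+_ ([k+1]*[n+1]C[k+1]≡[n+1]*nCk n k)
                                    ([k+1]*[n+1]C[k+1]≡[n+1]*nCk n (suc k))) ⟩
  a ℕ.+ ((1 ℕ.+ n) ℕ.* (n C k) ℕ.+ (1 ℕ.+ n) ℕ.* (n C suc k))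
    ≡⟨ cong (a ℕ.+_) (ℕ.*-distribˡ-+ (1 ℕ.+ n) (n C k) (n C suc k)) ⟨
  a ℕ.+ (1 ℕ.+ n) ℕ.* (n C k ℕ.+ n C suc k)
    ≡⟨ cong (λ c → a ℕ.+ (1 ℕ.+ n) ℕ.* c) (nCk+nC[k+1]≡[n+1]C[k+1] n k) ⟩
  (2 ℕ.+ n) ℕ.* a
    ∎
  where
  open ≡-Reasoning
  a = suc n C suc k
  b = suc n C suc (suc k)
  distribute : ∀ k a b → (2 ℕ.+ k) ℕ.* (a ℕ.+ b) ≡ a ℕ.+ ((1 ℕ.+ k) ℕ.* a ℕ.+ (2 ℕ.+ k) ℕ.* b)
  distribute = ℕ-Solver.solve-∀

fromℚᵘ-homo-+ : ∀ p q → fromℚᵘ (p ℚᵘ.+ q) ≡ fromℚᵘ p + fromℚᵘ q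
fromℚᵘ-homo-+ p q = toℚᵘ-injective (ℚᵘ.≃-trans (toℚᵘ-fromℚᵘ (p ℚᵘ.+ q)) (ℚᵘ.≃-sym
  (ℚᵘ.≃-trans (toℚᵘ-homo-+ (fromℚᵘ p) (fromℚᵘ q)) (ℚᵘ.+-cong (toℚᵘ-fromℚᵘ p) (toℚᵘ-fromℚᵘ q)))))

fromℚᵘ-homo-* : ∀ p q → fromℚᵘ (p ℚᵘ.* q) ≡ fromℚᵘ p * fromℚᵘ q
fromℚᵘ-homo-* p q = toℚᵘ-injective (ℚᵘ.≃-trans (toℚᵘ-fromℚᵘ (p ℚᵘ.* q)) (ℚᵘ.≃-sym
  (ℚᵘ.≃-trans (toℚᵘ-homo-* (fromℚᵘ p) (fromℚᵘ q)) (ℚᵘ.*-cong (toℚᵘ-fromℚᵘ p) (toℚᵘ-fromℚᵘ q)))))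

ℕ→ℚ-suc : ∀ n → ℕ→ℚ (suc n) ≡ 1ℚ + ℕ→ℚ n
ℕ→ℚ-suc n = trans (fromℚᵘ-cong {[1+n]ᵘ} {1ᵘ ℚᵘ.+ nᵘ} (ℚᵘ.*≡* (cross-multiplied (ℤ.+ n))))
                  (fromℚᵘ-homo-+ 1ᵘ nᵘ)
  where
  [1+n]ᵘ 1ᵘ nᵘ : ℚᵘ.ℚᵘ
  [1+n]ᵘ = ℚᵘ.mkℚᵘ (ℤ.+ suc n) 0
  1ᵘ     = ℚᵘ.mkℚᵘ (ℤ.+ 1) 0
  nᵘ     = ℚᵘ.mkℚᵘ (ℤ.+ n) 0
  cross-multiplied : ∀ x → (ℤ.1ℤ ℤ.+ x) ℤ.* ℤ.1ℤ ≡ (ℤ.1ℤ ℤ.* ℤ.1ℤ ℤ.+ x ℤ.* ℤ.1ℤ) ℤ.* ℤ.1ℤ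
  cross-multiplied = ℤ-Solver.solve-∀

ℕ→ℚ-+ : ∀ m n → ℕ→ℚ (m ℕ.+ n) ≡ ℕ→ℚ m + ℕ→ℚ n
ℕ→ℚ-+ zero    n = sym (+-identityˡ (ℕ→ℚ n))
ℕ→ℚ-+ (suc m) n = begin
  ℕ→ℚ (suc (m ℕ.+ n))          ≡⟨ ℕ→ℚ-suc (m ℕ.+ n) ⟩
  1ℚ + ℕ→ℚ (m ℕ.+ n)           ≡⟨ cong (1ℚ +_) (ℕ→ℚ-+ m n) ⟩
  1ℚ + (ℕ→ℚ m + ℕ→ℚ n)         ≡⟨ +-assoc 1ℚ (ℕ→ℚ m) (ℕ→ℚ n) ⟨
  (1ℚ + ℕ→ℚ m) + ℕ→ℚ n         ≡⟨ cong (_+ ℕ→ℚ n) (ℕ→ℚ-suc m) ⟨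
  ℕ→ℚ (suc m) + ℕ→ℚ n          ∎
  where open ≡-Reasoning

ℕ→ℚ-* : ∀ m n → ℕ→ℚ (m ℕ.* n) ≡ ℕ→ℚ m * ℕ→ℚ n
ℕ→ℚ-* zero    n = sym (*-zeroˡ (ℕ→ℚ n))
ℕ→ℚ-* (suc m) n = begin
  ℕ→ℚ (n ℕ.+ m ℕ.* n)          ≡⟨ ℕ→ℚ-+ n (m ℕ.* n) ⟩
  ℕ→ℚ n + ℕ→ℚ (m ℕ.* n)        ≡⟨ cong (ℕ→ℚ n +_) (ℕ→ℚ-* m n) ⟩
  ℕ→ℚ n + ℕ→ℚ m * ℕ→ℚ n        ≡⟨ y+x*y≡[1+x]*y (ℕ→ℚ m) (ℕ→ℚ n) ⟩
  (1ℚ + ℕ→ℚ m) * ℕ→ℚ n         ≡⟨ cong (_* ℕ→ℚ n) (ℕ→ℚ-suc m) ⟨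
  ℕ→ℚ (suc m) * ℕ→ℚ n          ∎
  where
  open ≡-Reasoning
  y+x*y≡[1+x]*y : ∀ x y → y + x * y ≡ (1ℚ + x) * y
  y+x*y≡[1+x]*y = solve 2 (λ x y → y :+ x :* y := (con 1ℚ :+ x) :* y) refl

ℕ→ℚ-*-inverse : ∀ m .{{_ : NonZero m}} → ℕ→ℚ m * (ℤ.+ 1 / m) ≡ 1ℚ
ℕ→ℚ-*-inverse (suc m) = trans (sym (fromℚᵘ-homo-* p (ℚᵘ.1/ p))) (fromℚᵘ-cong (ℚᵘ.*-inverseʳ p))
  where
  p = ℚᵘ.mkℚᵘ (ℤ.+ suc m) 0

ℕ→ℚ-*-cancelʳ : ∀ m .{{_ : NonZero m}} x → (ℕ→ℚ m * x) * (ℤ.+ 1 / m) ≡ x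
ℕ→ℚ-*-cancelʳ m x = begin
  (ℕ→ℚ m * x) * (ℤ.+ 1 / m)    ≡⟨ [a*x]*b≡x*[a*b] (ℕ→ℚ m) x (ℤ.+ 1 / m) ⟩
  x * (ℕ→ℚ m * (ℤ.+ 1 / m))    ≡⟨ cong (x *_) (ℕ→ℚ-*-inverse m) ⟩
  x * 1ℚ                       ≡⟨ *-identityʳ x ⟩
  x                            ∎
  where
  open ≡-Reasoning
  [a*x]*b≡x*[a*b] : ∀ a x b → (a * x) * b ≡ x * (a * b)
  [a*x]*b≡x*[a*b] = solve 3 (λ a x b → (a :* x) :* b := x :* (a :* b)) refl

neg-distrib-sum : ∀ {n} (f : Fin n → ℚ) → sum (λ i → - f i) ≡ - sum f
neg-distrib-sum {zero}  f = refl
neg-distrib-sum {suc n} f = begin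
  - f zero + sum (λ i → - f (suc i))   ≡⟨ cong (- f zero +_) (neg-distrib-sum (f ∘ suc)) ⟩
  - f zero + - sum (f ∘ suc)           ≡⟨ neg-distrib-+ (f zero) (sum (f ∘ suc)) ⟨
  - (f zero + sum (f ∘ suc))           ∎
  where open ≡-Reasoning

foldr-+-map-applyUpTo : ∀ n (f : ℕ → ℚ) (g : ℕ → ℕ) →
                        foldr _+_ 0ℚ (map f (applyUpTo g n)) ≡ ∑[ i < n ] f (g (toℕ i))
foldr-+-map-applyUpTo zero    f g = refl
foldr-+-map-applyUpTo (suc n) f g = cong (f (g 0) +_) (foldr-+-map-applyUpTo n f (g ∘ suc))

sum1to≡∑ : ∀ n f → sum1to n f ≡ ∑[ i < n ] f (suc (toℕ i))
sum1to≡∑ n f = foldr-+-map-applyUpTo n (f ∘ suc) id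

-- Σ_{k<L} C(N,k) (-1)^k f(k): the binomial transform of f, truncated after L terms
-- (for L > N nothing is lost, as C(N,k) = 0 for k > N).  Keeping the length L
-- independent of N is what lets Pascal's rule act on a sum of fixed length.
binomialTransform : ℕ → ℕ → (ℕ → ℚ) → ℚ
binomialTransform L N f = ∑[ i < L ] (ℕ→ℚ (N C toℕ i) * (sgn (toℕ i) * f (toℕ i)))

binomialTransform-+ : ∀ L N f g → binomialTransform L N (λ k → f k + g k)
                                ≡ binomialTransform L N f + binomialTransform L N g
binomialTransform-+ L N f g =
  trans (sum-cong-≗ (λ i → distrib (c i) (s i) (f (toℕ i)) (g (toℕ i))))
        (∑-distrib-+ (λ i → c i * (s i * f (toℕ i))) (λ i → c i * (s i * g (toℕ i))))
  where
  c s : Fin L → ℚ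
  c i = ℕ→ℚ (N C toℕ i)
  s i = sgn (toℕ i)
  distrib : ∀ c s x y → c * (s * (x + y)) ≡ c * (s * x) + c * (s * y)
  distrib = solve 4 (λ c s x y → c :* (s :* (x :+ y)) := c :* (s :* x) :+ c :* (s :* y)) refl

binomialTransform-neg : ∀ L N f → binomialTransform L N (λ k → - f k) ≡ - binomialTransform L N f
binomialTransform-neg L N f =
  trans (sum-cong-≗ (λ i → pull-neg (c i) (sgn (toℕ i)) (f (toℕ i))))
        (neg-distrib-sum (λ i → c i * (sgn (toℕ i) * f (toℕ i))))
  where
  c : Fin L → ℚ
  c i = ℕ→ℚ (N C toℕ i)
  pull-neg : ∀ c s x → c * (s * - x) ≡ - (c * (s * x))
  pull-neg = solve 3 (λ c s x → c :* (s :* (:- x)) := :- (c :* (s :* x))) refl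

binomialTransform-- : ∀ L N f g → binomialTransform L N (λ k → f k - g k)
                                ≡ binomialTransform L N f - binomialTransform L N g
binomialTransform-- L N f g =
  trans (binomialTransform-+ L N f (λ k → - g k)) (cong (binomialTransform L N f +_) (binomialTransform-neg L N g))

-- Both transforms start with the same k = 0 term, since N C 0 computes to 1.
binomialTransform-pascal : ∀ L N f → binomialTransform (suc L) (suc N) f
                         ≡ binomialTransform (suc L) N f - binomialTransform L N (f ∘ suc)
binomialTransform-pascal L N f = begin
  c N 0 0 + ∑[ i < L ] c (suc N) (suc (toℕ i)) (suc (toℕ i))
    ≡⟨ cong (c N 0 0 +_) (sum-cong-≗ {L} (λ i → split (toℕ i))) ⟩
  c N 0 0 + sum (λ i → X i + - Y i)
    ≡⟨ cong (c N 0 0 +_) (∑-distrib-+ X (λ i → - Y i)) ⟩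
  c N 0 0 + (sum X + sum (λ i → - Y i))
    ≡⟨ cong (λ y → c N 0 0 + (sum X + y)) (neg-distrib-sum Y) ⟩
  c N 0 0 + (sum X + - sum Y)
    ≡⟨ +-assoc (c N 0 0) (sum X) (- sum Y) ⟨
  binomialTransform (suc L) N f - binomialTransform L N (f ∘ suc)
    ∎
  where
  open ≡-Reasoning
  c : ℕ → ℕ → ℕ → ℚ
  c n k j = ℕ→ℚ (n C k) * (sgn k * f j)
  X Y : Fin L → ℚ
  X i = c N (suc (toℕ i)) (suc (toℕ i))
  Y i = c N (toℕ i) (suc (toℕ i))
  rearrange : ∀ a b s x → (a + b) * (- s * x) ≡ b * (- s * x) + - (a * (s * x))
  rearrange = solve 4 (λ a b s x → (a :+ b) :* ((:- s) :* x) := b :* ((:- s) :* x) :+ (:- (a :* (s :* x)))) refl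
  split : ∀ k → c (suc N) (suc k) (suc k) ≡ c N (suc k) (suc k) + - c N k (suc k)
  split k = begin
    ℕ→ℚ (suc N C suc k) * (- sgn k * f (suc k))
      ≡⟨ cong (λ m → ℕ→ℚ m * (- sgn k * f (suc k))) (nCk+nC[k+1]≡[n+1]C[k+1] N k) ⟨
    ℕ→ℚ (N C k ℕ.+ N C suc k) * (- sgn k * f (suc k))
      ≡⟨ cong (_* (- sgn k * f (suc k))) (ℕ→ℚ-+ (N C k) (N C suc k)) ⟩
    (ℕ→ℚ (N C k) + ℕ→ℚ (N C suc k)) * (- sgn k * f (suc k))
      ≡⟨ rearrange (ℕ→ℚ (N C k)) (ℕ→ℚ (N C suc k)) (sgn k) (f (suc k)) ⟩
    c N (suc k) (suc k) + - c N k (suc k)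
      ∎

binomialTransform₀ : ∀ L f → binomialTransform (suc L) 0 f ≡ f 0
binomialTransform₀ L f = begin
  1ℚ * (1ℚ * f 0) + ∑[ i < L ] (0ℚ * (sgn (suc (toℕ i)) * f (suc (toℕ i))))
    ≡⟨ cong₂ _+_ (trans (*-identityˡ _) (*-identityˡ (f 0)))
                 (sum-cong-≗ {L} (λ i → *-zeroˡ (sgn (suc (toℕ i)) * f (suc (toℕ i))))) ⟩
  f 0 + sum {L} (λ _ → 0ℚ)
    ≡⟨ cong (f 0 +_) (sum-replicate-zero L) ⟩
  f 0 + 0ℚ
    ≡⟨ +-identityʳ (f 0) ⟩
  f 0
    ∎
  where open ≡-Reasoning

binomialTransform-const≡0 : ∀ {N L} → N < L → ∀ x → binomialTransform (suc L) (suc N) (λ _ → x) ≡ 0ℚ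
binomialTransform-const≡0 {zero}  {suc L} _          x = begin
  binomialTransform (suc (suc L)) 1 (λ _ → x)
    ≡⟨ binomialTransform-pascal (suc L) 0 (λ _ → x) ⟩
  binomialTransform (suc (suc L)) 0 (λ _ → x) - binomialTransform (suc L) 0 (λ _ → x)
    ≡⟨ cong₂ _-_ (binomialTransform₀ (suc L) (λ _ → x)) (binomialTransform₀ L (λ _ → x)) ⟩
  x - x
    ≡⟨ +-inverseʳ x ⟩
  0ℚ
    ∎
  where open ≡-Reasoning
binomialTransform-const≡0 {suc N} {suc L} (s≤s N<L) x =
  trans (binomialTransform-pascal (suc L) (suc N) (λ _ → x))
        (cong₂ _-_ (binomialTransform-const≡0 (ℕ.m<n⇒m<1+n N<L) x) (binomialTransform-const≡0 N<L x))

1/suc : ℕ → ℚ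
1/suc k = ℤ.+ 1 / suc k

ℕ→ℚ-*-binomialTransform-1/suc : ∀ L N → ℕ→ℚ (suc N) * binomialTransform L N 1/suc
                               ≡ 1ℚ - binomialTransform (suc L) (suc N) (λ _ → 1ℚ)
ℕ→ℚ-*-binomialTransform-1/suc L N = begin
  n * binomialTransform L N 1/suc
    ≡⟨ *-distribˡ-sum {L} n (λ i → c N (toℕ i) * (sgn (toℕ i) * 1/suc (toℕ i))) ⟩
  ∑[ i < L ] (n * (c N (toℕ i) * (sgn (toℕ i) * 1/suc (toℕ i))))
    ≡⟨ sum-cong-≗ {L} (λ i → absorb (toℕ i)) ⟩
  ∑[ i < L ] (- H (suc (toℕ i)))
    ≡⟨ neg-distrib-sum {L} (λ i → H (suc (toℕ i))) ⟩
  - ∑[ i < L ] H (suc (toℕ i))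
    ≡⟨ neg≡1-[1+] (∑[ i < L ] H (suc (toℕ i))) ⟩
  1ℚ - binomialTransform (suc L) (suc N) (λ _ → 1ℚ)
    ∎
  where
  open ≡-Reasoning
  n : ℚ
  n = ℕ→ℚ (suc N)
  c : ℕ → ℕ → ℚ
  c m k = ℕ→ℚ (m C k)
  H : ℕ → ℚ
  H k = c (suc N) k * (sgn k * 1ℚ)
  neg≡1-[1+] : ∀ y → - y ≡ 1ℚ - (1ℚ + y)
  neg≡1-[1+] = solve 1 (λ y → :- y := con 1ℚ :- (con 1ℚ :+ y)) refl
  rearrange : ∀ a b s i → (a * b) * (s * i) ≡ (b * s) * (a * i)
  rearrange = solve 4 (λ a b s i → (a :* b) :* (s :* i) := (b :* s) :* (a :* i)) refl
  finish : ∀ b s → (b * s) * 1ℚ ≡ - (b * (- s * 1ℚ))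
  finish = solve 2 (λ b s → (b :* s) :* con 1ℚ := :- (b :* ((:- s) :* con 1ℚ))) refl
  absorption : ∀ k → n * c N k ≡ ℕ→ℚ (suc k) * c (suc N) (suc k)
  absorption k = begin
    n * c N k                               ≡⟨ ℕ→ℚ-* (suc N) (N C k) ⟨
    ℕ→ℚ (suc N ℕ.* (N C k))                 ≡⟨ cong ℕ→ℚ ([k+1]*[n+1]C[k+1]≡[n+1]*nCk N k) ⟨
    ℕ→ℚ (suc k ℕ.* (suc N C suc k))         ≡⟨ ℕ→ℚ-* (suc k) (suc N C suc k) ⟩
    ℕ→ℚ (suc k) * c (suc N) (suc k)         ∎
  absorb : ∀ k → n * (c N k * (sgn k * 1/suc k)) ≡ - H (suc k)
  absorb k = begin
    n * (c N k * (sgn k * 1/suc k))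
      ≡⟨ *-assoc n (c N k) (sgn k * 1/suc k) ⟨
    (n * c N k) * (sgn k * 1/suc k)
      ≡⟨ cong (_* (sgn k * 1/suc k)) (absorption k) ⟩
    (ℕ→ℚ (suc k) * c (suc N) (suc k)) * (sgn k * 1/suc k)
      ≡⟨ rearrange (ℕ→ℚ (suc k)) (c (suc N) (suc k)) (sgn k) (1/suc k) ⟩
    (c (suc N) (suc k) * sgn k) * (ℕ→ℚ (suc k) * 1/suc k)
      ≡⟨ cong (c (suc N) (suc k) * sgn k *_) (ℕ→ℚ-*-inverse (suc k)) ⟩
    (c (suc N) (suc k) * sgn k) * 1ℚ
      ≡⟨ finish (c (suc N) (suc k)) (sgn k) ⟩
    - H (suc k)
      ∎

binomialTransform-1/suc : ∀ {N L} → N < L → binomialTransform L N 1/suc ≡ 1/suc N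
binomialTransform-1/suc {N} {suc L} N<1+L = begin
  T                                ≡⟨ ℕ→ℚ-*-cancelʳ (suc N) T ⟨
  (ℕ→ℚ (suc N) * T) * 1/suc N      ≡⟨ cong (_* 1/suc N) (ℕ→ℚ-*-binomialTransform-1/suc (suc L) N) ⟩
  (1ℚ - T′) * 1/suc N              ≡⟨ cong (λ y → (1ℚ - y) * 1/suc N) (binomialTransform-const≡0 N<1+L 1ℚ) ⟩
  (1ℚ - 0ℚ) * 1/suc N              ≡⟨ *-identityˡ (1/suc N) ⟩
  1/suc N                          ∎
  where
  open ≡-Reasoning
  T T′ : ℚ
  T  = binomialTransform (suc L) N 1/suc
  T′ = binomialTransform (suc (suc L)) (suc N) (λ _ → 1ℚ)

x-[x-y]≡y : ∀ x y → x - (x - y) ≡ y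
x-[x-y]≡y = solve 2 (λ x y → x :- (x :- y) := y) refl

binomialTransform-1/suc∘suc : ∀ N → binomialTransform (suc N) N (1/suc ∘ suc) ≡ 1/suc N - 1/suc (suc N)
binomialTransform-1/suc∘suc N = begin
  X                          ≡⟨ x-[x-y]≡y (1/suc N) X ⟨
  1/suc N - (1/suc N - X)    ≡⟨ cong (λ y → 1/suc N - y) pascal ⟨
  1/suc N - 1/suc (suc N)    ∎
  where
  open ≡-Reasoning
  X : ℚ
  X = binomialTransform (suc N) N (1/suc ∘ suc)
  pascal : 1/suc (suc N) ≡ 1/suc N - X
  pascal = begin
    1/suc (suc N)                                      ≡⟨ binomialTransform-1/suc (n<1+n (suc N)) ⟨
    binomialTransform (suc (suc N)) (suc N) 1/suc      ≡⟨ binomialTransform-pascal (suc N) N 1/suc ⟩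
    binomialTransform (suc (suc N)) N 1/suc - X        ≡⟨ cong (_- X) (binomialTransform-1/suc (ℕ.m<n⇒m<1+n (n<1+n N))) ⟩
    1/suc N - X                                        ∎

sgn-*-sgn : ∀ n x → sgn n * (sgn n * x) ≡ x
sgn-*-sgn zero    x = trans (*-identityˡ (1ℚ * x)) (*-identityˡ x)
sgn-*-sgn (suc n) x = trans (neg-*-neg (sgn n) x) (sgn-*-sgn n x)
  where
  neg-*-neg : ∀ s x → - s * (- s * x) ≡ s * (s * x)
  neg-*-neg = solve 2 (λ s x → (:- s) :* ((:- s) :* x) := s :* (s :* x)) refl

D/n! : ∀ n → D n * invFact n ≡ sgn n * 1/suc n
D/n! n = ℕ→ℚ-*-cancelʳ (n !) {{n !≢0}} (sgn n * 1/suc n)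

Dhat/n! : ∀ n → Dhat (suc n) * invFact (suc n) ≡ sgn n * (1/suc n - 1/suc (suc n))
Dhat/n! n = trans (ℕ→ℚ-*-cancelʳ (suc n !) {{suc n !≢0}} (- sgn n * b + sgn n * a)) (factor (sgn n) a b)
  where
  a b : ℚ
  a = 1/suc n
  b = 1/suc (suc n)
  factor : ∀ s a b → - s * b + s * a ≡ s * (a - b)
  factor = solve 3 (λ s a b → (:- s) :* b :+ s :* a := s :* (a :- b)) refl

∑-C*Dhat/n! : ∀ N → ∑[ i < suc N ] (ℕ→ℚ (N C toℕ i) * (Dhat (suc (toℕ i)) * invFact (suc (toℕ i))))
                  ≡ 1/suc (suc N)
∑-C*Dhat/n! N = begin
  ∑[ i < suc N ] (ℕ→ℚ (N C toℕ i) * (Dhat (suc (toℕ i)) * invFact (suc (toℕ i))))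
    ≡⟨ sum-cong-≗ {suc N} (λ i → cong (ℕ→ℚ (N C toℕ i) *_) (Dhat/n! (toℕ i))) ⟩
  binomialTransform (suc N) N (λ k → 1/suc k - 1/suc (suc k))
    ≡⟨ binomialTransform-- (suc N) N 1/suc (1/suc ∘ suc) ⟩
  binomialTransform (suc N) N 1/suc - binomialTransform (suc N) N (1/suc ∘ suc)
    ≡⟨ cong₂ _-_ (binomialTransform-1/suc (n<1+n N)) (binomialTransform-1/suc∘suc N) ⟩
  1/suc N - (1/suc N - 1/suc (suc N))
    ≡⟨ x-[x-y]≡y (1/suc N) (1/suc (suc N)) ⟩
  1/suc (suc N)
    ∎
  where open ≡-Reasoning

∑-C*D/n! : ∀ N → ∑[ i < suc N ] (ℕ→ℚ (N C toℕ i) * (D (suc (toℕ i)) * invFact (suc (toℕ i))))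
               ≡ - (1/suc N - 1/suc (suc N))
∑-C*D/n! N = begin
  ∑[ i < suc N ] (ℕ→ℚ (N C toℕ i) * (D (suc (toℕ i)) * invFact (suc (toℕ i))))
    ≡⟨ sum-cong-≗ {suc N} (λ i → cong (ℕ→ℚ (N C toℕ i) *_) (move-neg (toℕ i))) ⟩
  binomialTransform (suc N) N (λ k → - 1/suc (suc k))
    ≡⟨ binomialTransform-neg (suc N) N (1/suc ∘ suc) ⟩
  - binomialTransform (suc N) N (1/suc ∘ suc)
    ≡⟨ cong -_ (binomialTransform-1/suc∘suc N) ⟩
  - (1/suc N - 1/suc (suc N))
    ∎
  where
  open ≡-Reasoning
  move-neg : ∀ k → D (suc k) * invFact (suc k) ≡ sgn k * - 1/suc (suc k)
  move-neg k = trans (D/n! (suc k)) (trans (sym (neg-distribˡ-* (sgn k) (1/suc (suc k))))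
                                           (neg-distribʳ-* (sgn k) (1/suc (suc k))))

theorem8 : (n : ℕ) → 1 ≤ n →
    (sgn n * (D n * invFact n)
       ≡ sum1to n (λ m → ℕ→ℚ ((n ∸ 1) C (m ∸ 1)) * (Dhat m * invFact m)))
    × (sgn n * (Dhat n * invFact n)
       ≡ sum1to n (λ m → ℕ→ℚ ((n ∸ 1) C (m ∸ 1)) * (D m * invFact m)))
theorem8 (suc N) _ = D-identity , Dhat-identity
  where
  open ≡-Reasoning
  weighted : (ℕ → ℚ) → ℕ → ℚ
  weighted a m = ℕ→ℚ (N C (m ∸ 1)) * (a m * invFact m)
  D-identity : sgn (suc N) * (D (suc N) * invFact (suc N)) ≡ sum1to (suc N) (weighted Dhat)
  D-identity = begin
    sgn (suc N) * (D (suc N) * invFact (suc N))      ≡⟨ cong (sgn (suc N) *_) (D/n! (suc N)) ⟩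
    sgn (suc N) * (sgn (suc N) * 1/suc (suc N))      ≡⟨ sgn-*-sgn (suc N) (1/suc (suc N)) ⟩
    1/suc (suc N)                                    ≡⟨ ∑-C*Dhat/n! N ⟨
    ∑[ i < suc N ] weighted Dhat (suc (toℕ i))       ≡⟨ sum1to≡∑ (suc N) (weighted Dhat) ⟨
    sum1to (suc N) (weighted Dhat)                   ∎
  Dhat-identity : sgn (suc N) * (Dhat (suc N) * invFact (suc N)) ≡ sum1to (suc N) (weighted D)
  Dhat-identity = begin
    sgn (suc N) * (Dhat (suc N) * invFact (suc N))   ≡⟨ cong (sgn (suc N) *_) (Dhat/n! N) ⟩
    - sgn N * (sgn N * (1/suc N - 1/suc (suc N)))    ≡⟨ neg-distribˡ-* (sgn N) _ ⟨
    - (sgn N * (sgn N * (1/suc N - 1/suc (suc N))))  ≡⟨ cong -_ (sgn-*-sgn N _) ⟩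
    - (1/suc N - 1/suc (suc N))                      ≡⟨ ∑-C*D/n! N ⟨
    ∑[ i < suc N ] weighted D (suc (toℕ i))          ≡⟨ sum1to≡∑ (suc N) (weighted D) ⟨
    sum1to (suc N) (weighted D)                      ∎
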